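{- Let $G=(V,E)$ be a finite undirected graph with $V\neq\emptyset$, and let $\emptyset=B_0\subsetneq B_1\subsetneq\cdots\subsetneq B_k=V$ be all the locally dense subsets of $V$, listed in increasing order. Then $B_1$ is a densest subgraph of $G$, i.e. $d(B_1)=\max_{\emptyset\neq X\subseteq V} d(X)$.
   Context: For $X\subseteq V$, $E(X)=\{(x,y)\in E: x,y\in X\}$ and for nonempty $X$, $d(X)=|E(X)|/|X|$. For disjoint $X,Y$, $E(X,Y)$ is the set of edges with one endpoint in $X$ and one in $Y$, $E_m(X,Y)=E(X)\cup E(X,Y)$, and for nonempty $X$ disjoint from $Y$, $d(X,Y)=|E_m(X,Y)|/|X|$; in general $d(X,Y)=d(X\setminus Y,Y)$. A set $W\subseteq V$ is locally dense if there do not exist a nonempty $X\subseteq W$ and a nonempty $Y\subseteq V$ with $Y\cap W=\emptyset$ such that $d(X,W\setminus X)\le d(Y,W)$. -}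

module Defs where

open import Data.Nat using (ℕ; zero; suc; _+_; _*_; _≤_; _<ᵇ_)
open import Data.Bool using (Bool; true; false; _∧_; if_then_else_)
open import Data.Fin using (Fin; zero; suc; toℕ)
open import Data.Fin.Subset using (Subset; _∈_; _⊆_; _∩_; _─_; ∣_∣; Nonempty; Empty)
open import Data.Vec using (lookup)
open import Data.Product using (Σ; _×_; ∃)
open import Relation.Nullary using (¬_)
open import Relation.Binary.PropositionalEquality using (_≡_)

record Graph (n : ℕ) : Set where
  field
    adj   : Fin n → Fin n → Bool
    sym   : ∀ i j → adj i j ≡ adj j i
    loopless : ∀ i → adj i i ≡ false

open Graph public

count : ∀ {n} → (Fin n → Bool) → ℕ
count {zero}  f = 0
count {suc n} f = (if f zero then 1 else 0) + count (λ i → f (suc i))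

sumF : ∀ {n} → (Fin n → ℕ) → ℕ
sumF {zero}  f = 0
sumF {suc n} f = f zero + sumF (λ i → f (suc i))

module _ {n : ℕ} (G : Graph n) where

  -- |E(X)| : each unordered edge {i,j} counted once (as i < j)
  eIn : Subset n → ℕ
  eIn X = sumF λ i → count λ j →
            (toℕ i <ᵇ toℕ j) ∧ adj G i j ∧ lookup X i ∧ lookup X j

  -- |E(X,Y)| for disjoint X, Y : edges with one endpoint in X and one in Y
  -- (each such edge counted once, via its endpoint in X)
  eBetween : Subset n → Subset n → ℕ
  eBetween X Y = sumF λ i → count λ j → adj G i j ∧ lookup X i ∧ lookup Y j

  -- |E_m(X,Y)| = |E(X ∖ Y)| + |E(X ∖ Y, Y)|  (disjoint union), with the
  -- general convention d(X,Y) = d(X ∖ Y, Y)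
  eM : Subset n → Subset n → ℕ
  eM X Y = eIn (X ─ Y) + eBetween (X ─ Y) Y

  -- d(X) ≤ d(Y) for nonempty X, Y, i.e. |E(X)|/|X| ≤ |E(Y)|/|Y|,
  -- written by cross-multiplication of the (positive) denominators
  _d≤d_ : Subset n → Subset n → Set
  X d≤d Y = eIn X * ∣ Y ∣ ≤ eIn Y * ∣ X ∣

  -- d(X,A) ≤ d(Y,B), i.e. |E_m(X∖A,A)|/|X∖A| ≤ |E_m(Y∖B,B)|/|Y∖B|,
  -- by cross-multiplication
  dm≤dm : Subset n → Subset n → Subset n → Subset n → Set
  dm≤dm X A Y B = eM X A * ∣ Y ─ B ∣ ≤ eM Y B * ∣ X ─ A ∣

  LocallyDense : Subset n → Set
  LocallyDense W = ¬ (Σ (Subset n) λ X → Σ (Subset n) λ Y →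
      Nonempty X × X ⊆ W × Nonempty Y × Empty (Y ∩ W) ×
      dm≤dm X (W ─ X) Y W)

-- Let D be a densest subgraph of maximum size. D is locally dense: for X ⊆ D, the rest D ∖ X is
-- no denser than D, so X counted with its edges into D ∖ X is at least as dense as D; a set Y
-- outside D counted with its edges into D is strictly sparser than D, as otherwise D ∪ Y would be
-- a larger densest subgraph. So D = B j with j ≥ 1, and the chain gives B₁ ⊆ D. If B₁ ≠ D then,
-- since d(B₁) ≤ d(D), the rest D ∖ B₁ counted with its edges into B₁ is at least as dense as B₁,
-- so X = B₁ and Y = D ∖ B₁ witness that B₁ is not locally dense. Hence B₁ = D.
module Submission where

open import Defs hiding (sym)

open import Data.Bool using (Bool; true; false; T; _∧_; _∨_; not; if_then_else_)
open import Data.Bool.Properties using (∧-comm; ∧-zeroʳ; ∧-identityʳ; T-≡)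
open import Data.Empty using (⊥-elim)
open import Data.Fin using (Fin; zero; suc; toℕ; fromℕ; inject₁)
open import Data.Fin.Properties using (toℕ-injective; ¬Fin0)
open import Data.Fin.Subset
open import Data.Fin.Subset.Properties
open import Data.List using (List; []; _∷_; map; _++_)
open import Data.List.Membership.Propositional using () renaming (_∈_ to _∈ₗ_)
open import Data.List.Membership.Propositional.Properties using (∈-++⁺ˡ; ∈-++⁺ʳ; ∈-map⁺)
open import Data.List.Relation.Unary.All as All using (All; []; _∷_)
open import Data.List.Relation.Unary.Any using (here; there)
open import Data.Nat using (ℕ; zero; suc; _+_; _*_; _≤_; _<_; _<ᵇ_; z≤n; z<s)
open import Data.Nat.Properties
open import Algebra.Properties.CommutativeMonoid.Sum +-0-commutativeMonoid
  using (sum; sum-cong-≗; ∑-distrib-+; ∑-comm; sum-replicate-zero)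
open import Data.Nat.Tactic.RingSolver using (solve-∀)
open import Data.Product using (Σ; _×_; ∃; _,_; proj₁; proj₂)
open import Data.Sum using (_⊎_; inj₁; inj₂; [_,_]′)
open import Data.Vec using ([]; _∷_; lookup; here; there)
open import Data.Vec.Properties using (lookup-zipWith; lookup-replicate)
open import Function using (_∘_; _on_; id)
open import Function.Bundles using (Equivalence; _⇔_)
open import Relation.Binary.Definitions using (Total; Transitive; tri<; tri≈; tri>)
open import Relation.Binary.PropositionalEquality
open import Relation.Nullary using (Dec; _×-dec_; ¬_; contradiction; yes; no)

⟦_⟧ : Bool → ℕ
⟦ b ⟧ = if b then 1 else 0

sumF≡sum : ∀ {m} (f : Fin m → ℕ) → sumF f ≡ sum f
sumF≡sum {zero}  f = refl
sumF≡sum {suc m} f = cong (f zero +_) (sumF≡sum (f ∘ suc))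

count≡sum : ∀ {m} (f : Fin m → Bool) → count f ≡ sum (⟦_⟧ ∘ f)
count≡sum {zero}  f = refl
count≡sum {suc m} f = cong (⟦ f zero ⟧ +_) (count≡sum (f ∘ suc))

ΣΣ : ∀ {m} → (Fin m → Fin m → ℕ) → ℕ
ΣΣ f = sum λ i → sum λ j → f i j

sumF-count≡ΣΣ : ∀ {m} (f : Fin m → Fin m → Bool) → sumF (λ i → count (f i)) ≡ ΣΣ λ i j → ⟦ f i j ⟧
sumF-count≡ΣΣ f = trans (sumF≡sum (count ∘ f)) (sum-cong-≗ (count≡sum ∘ f))

ΣΣ-cong : ∀ {m} {f g : Fin m → Fin m → ℕ} → (∀ i j → f i j ≡ g i j) → ΣΣ f ≡ ΣΣ g
ΣΣ-cong f≗g = sum-cong-≗ λ i → sum-cong-≗ (f≗g i)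

ΣΣ-distrib-+ : ∀ {m} (f g : Fin m → Fin m → ℕ) → ΣΣ (λ i j → f i j + g i j) ≡ ΣΣ f + ΣΣ g
ΣΣ-distrib-+ f g = trans (sum-cong-≗ λ i → ∑-distrib-+ (f i) (g i)) (∑-distrib-+ (sum ∘ f) (sum ∘ g))

ΣΣ-zero : ∀ {m} (f : Fin m → Fin m → ℕ) → (∀ i j → f i j ≡ 0) → ΣΣ f ≡ 0
ΣΣ-zero {m} f f≗0 = trans (sum-cong-≗ λ i → trans (sum-cong-≗ (f≗0 i)) (sum-replicate-zero m))
                          (sum-replicate-zero m)

lookup-─ : ∀ {m} (p q : Subset m) i → lookup (p ─ q) i ≡ lookup p i ∧ not (lookup q i)
lookup-─ (x ∷ p) (true  ∷ q) zero    = sym (∧-zeroʳ x)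
lookup-─ (x ∷ p) (false ∷ q) zero    = sym (∧-identityʳ x)
lookup-─ (x ∷ p) (y     ∷ q) (suc i) = lookup-─ p q i

p∪[q─p]≡p∪q : ∀ {m} (p q : Subset m) → p ∪ (q ─ p) ≡ p ∪ q
p∪[q─p]≡p∪q []          []      = refl
p∪[q─p]≡p∪q (true  ∷ p) (y ∷ q) = cong (true ∷_) (p∪[q─p]≡p∪q p q)
p∪[q─p]≡p∪q (false ∷ p) (y ∷ q) = cong (y ∷_) (p∪[q─p]≡p∪q p q)

∣p∪q∣≡∣p∣+∣q─p∣ : ∀ {m} (p q : Subset m) → ∣ p ∪ q ∣ ≡ ∣ p ∣ + ∣ q ─ p ∣
∣p∪q∣≡∣p∣+∣q─p∣ []          []          = refl
∣p∪q∣≡∣p∣+∣q─p∣ (true  ∷ p) (y     ∷ q) = cong suc (∣p∪q∣≡∣p∣+∣q─p∣ p q)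
∣p∪q∣≡∣p∣+∣q─p∣ (false ∷ p) (true  ∷ q) =
  trans (cong suc (∣p∪q∣≡∣p∣+∣q─p∣ p q)) (sym (+-suc ∣ p ∣ ∣ q ─ p ∣))
∣p∪q∣≡∣p∣+∣q─p∣ (false ∷ p) (false ∷ q) = ∣p∪q∣≡∣p∣+∣q─p∣ p q

p─p≡⊥ : ∀ {m} (p : Subset m) → p ─ p ≡ ⊥
p─p≡⊥ []          = refl
p─p≡⊥ (true  ∷ p) = cong (false ∷_) (p─p≡⊥ p)
p─p≡⊥ (false ∷ p) = cong (false ∷_) (p─p≡⊥ p)

x∈q⇒x∉p─q : ∀ {m} {x : Fin m} {p q : Subset m} → x ∈ q → x ∉ p ─ q
x∈q⇒x∉p─q {p = y ∷ p} {true ∷ q} here        ()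
x∈q⇒x∉p─q {p = y ∷ p} {z    ∷ q} (there x∈q) (there x∈p─q) = x∈q⇒x∉p─q x∈q x∈p─q

disjoint-─ : ∀ {m} (p q : Subset m) i → lookup p i ∧ lookup (q ─ p) i ≡ false
disjoint-─ p q i with lookup p i in eq
... | true  = trans (lookup-─ q p i) (trans (cong (λ b → lookup q i ∧ not b) eq) (∧-zeroʳ _))
... | false = refl

p⊆q⇒p∪q≡q : ∀ {m} {p q : Subset m} → p ⊆ q → p ∪ q ≡ q
p⊆q⇒p∪q≡q {p = p} {q} p⊆q = ⊆-antisym (λ x∈p∪q → [ p⊆q , id ]′ (x∈p∪q⁻ p q x∈p∪q)) (q⊆p∪q p q)

q─p∪p≡q : ∀ {m} {p q : Subset m} → p ⊆ q → (q ─ p) ∪ p ≡ q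
q─p∪p≡q {p = p} {q} p⊆q = trans (∪-comm (q ─ p) p) (trans (p∪[q─p]≡p∪q p q) (p⊆q⇒p∪q≡q p⊆q))

Nonempty⇒0<∣p∣ : ∀ {m} {p : Subset m} → Nonempty p → 0 < ∣ p ∣
Nonempty⇒0<∣p∣ {p = p} (x , x∈p) =
  subst (_≤ ∣ p ∣) (∣⁅x⁆∣≡1 x) (p⊆q⇒∣p∣≤∣q∣ ⁅x⁆⊆p)
  where
  ⁅x⁆⊆p : ⁅ x ⁆ ⊆ p
  ⁅x⁆⊆p y∈⁅x⁆ = subst (_∈ p) (sym (x∈⁅y⁆⇒x≡y x y∈⁅x⁆)) x∈p

0<∣p∣⇒Nonempty : ∀ {m} {p : Subset m} → 0 < ∣ p ∣ → Nonempty p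
0<∣p∣⇒Nonempty {m} {p} 0<∣p∣ with nonempty? p
... | yes ne  = ne
... | no  ¬ne = contradiction (trans (cong ∣_∣ (Empty-unique ¬ne)) (∣⊥∣≡0 m)) (>⇒≢ 0<∣p∣)

-- A fraction a/b ≤ c/d is written a * d ≤ c * b, as in _d≤d_; (a + c)/(b + d) is the mediant.
≤-mediant⇒≤ : ∀ a b c d → a * (b + d) ≤ (a + c) * b → a * d ≤ c * b
≤-mediant⇒≤ a b c d h =
  +-cancelˡ-≤ (a * b) (a * d) (c * b) (subst₂ _≤_ (*-distribˡ-+ a b d) (*-distribʳ-+ b a c) h)

≤⇒mediant≤ : ∀ a b c d → a * d ≤ c * b → (a + c) * d ≤ c * (b + d)
≤⇒mediant≤ a b c d h =
  subst₂ _≤_ (sym (*-distribʳ-+ d a c)) (sym (*-distribˡ-+ c b d)) (+-monoˡ-≤ (c * d) h)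

mediant<⇒< : ∀ a b c d → (a + c) * b < a * (b + d) → c * b < a * d
mediant<⇒< a b c d h =
  +-cancelˡ-< (a * b) (c * b) (a * d) (subst₂ _<_ (*-distribʳ-+ b a c) (*-distribˡ-+ a b d) h)

cross-≤-trans : ∀ a b c d e f → 0 < d → a * d ≤ c * b → c * f ≤ e * d → a * f ≤ e * b
cross-≤-trans a b c d@(suc _) e f _ ad≤cb cf≤ed = *-cancelʳ-≤ (a * f) (e * b) d (begin
  a * f * d  ≡⟨ swap₂₃ a f d ⟩
  a * d * f  ≤⟨ *-monoˡ-≤ f ad≤cb ⟩
  c * b * f  ≡⟨ swap₂₃ c b f ⟩
  c * f * b  ≤⟨ *-monoˡ-≤ b cf≤ed ⟩
  e * d * b  ≡⟨ swap₂₃ e d b ⟩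
  e * b * d  ∎)
  where
  open ≤-Reasoning
  swap₂₃ : ∀ x y z → x * y * z ≡ x * z * y
  swap₂₃ = solve-∀

-- Fractions with denominator 0 are put below all others, which makes the order total.
_≤ᶠ_ : ℕ × ℕ → ℕ × ℕ → Set
(a , b) ≤ᶠ (c , d) = b ≡ 0 ⊎ (0 < d × a * d ≤ c * b)

≤ᶠ-total : Total _≤ᶠ_
≤ᶠ-total (a , zero)  _           = inj₁ (inj₁ refl)
≤ᶠ-total (a , suc b) (c , zero)  = inj₂ (inj₁ refl)
≤ᶠ-total (a , suc b) (c , suc d) with ≤-total (a * suc d) (c * suc b)
... | inj₁ ≤ = inj₁ (inj₂ (z<s , ≤))
... | inj₂ ≥ = inj₂ (inj₂ (z<s , ≥))

≤ᶠ-trans : Transitive _≤ᶠ_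
≤ᶠ-trans (inj₁ b≡0)        _                  = inj₁ b≡0
≤ᶠ-trans (inj₂ (0<d , _))  (inj₁ d≡0)         = contradiction d≡0 (>⇒≢ 0<d)
≤ᶠ-trans {a , b} {c , d} {e , f} (inj₂ (0<d , ≤₁)) (inj₂ (0<f , ≤₂)) =
  inj₂ (0<f , cross-≤-trans a b c d e f 0<d ≤₁ ≤₂)

module _ {A : Set} {_≼_ : A → A → Set} (total : Total _≼_) (trans≼ : Transitive _≼_) where

  private
    total⇒refl : ∀ x → x ≼ x
    total⇒refl x = [ id , id ]′ (total x x)

  upper-bound : ∀ x xs → ∃ λ m → All (_≼ m) (x ∷ xs)
  upper-bound x []       = x , total⇒refl x ∷ []
  upper-bound x (y ∷ ys) with upper-bound y ys
  ... | m , ≼m with total x m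
  ...   | inj₁ x≼m = m , x≼m ∷ ≼m
  ...   | inj₂ m≼x = x , total⇒refl x ∷ All.map (λ z≼m → trans≼ z≼m m≼x) ≼m

allSubsets : ∀ m → List (Subset m)
allSubsets zero    = [] ∷ []
allSubsets (suc m) = map (true ∷_) (allSubsets m) ++ map (false ∷_) (allSubsets m)

∈-allSubsets : ∀ {m} (p : Subset m) → p ∈ₗ allSubsets m
∈-allSubsets []                = here refl
∈-allSubsets (true  ∷ p)       = ∈-++⁺ˡ (∈-map⁺ (true ∷_) (∈-allSubsets p))
∈-allSubsets {suc m} (false ∷ p) = ∈-++⁺ʳ (map (true ∷_) (allSubsets m)) (∈-map⁺ (false ∷_) (∈-allSubsets p))

maximum : ∀ {m} {_≼_ : Subset m → Subset m → Set} → Total _≼_ → Transitive _≼_ → ∃ λ M → ∀ Y → Y ≼ M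
maximum {m} total trans≼ with upper-bound total trans≼ ⊥ (allSubsets m)
... | M , ≼M = M , λ Y → All.lookup ≼M (there (∈-allSubsets Y))

module _ {m} {P : Subset m → Set} (P? : ∀ Y → Dec (P Y)) (f : Subset m → ℕ) where

  private
    _≼_ : Subset m → Subset m → Set
    Y ≼ X = ¬ P Y ⊎ (P X × f Y ≤ f X)

    ≼-total : Total _≼_
    ≼-total Y X with P? Y | P? X
    ... | no ¬PY | _      = inj₁ (inj₁ ¬PY)
    ... | yes _  | no ¬PX = inj₂ (inj₁ ¬PX)
    ... | yes PY | yes PX =
      [ (λ ≤ → inj₁ (inj₂ (PX , ≤))) , (λ ≥ → inj₂ (inj₂ (PY , ≥))) ]′ (≤-total (f Y) (f X))

    ≼-trans : Transitive _≼_
    ≼-trans (inj₁ ¬PX)      _                = inj₁ ¬PX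
    ≼-trans (inj₂ (PY , _)) (inj₁ ¬PY)       = contradiction PY ¬PY
    ≼-trans (inj₂ (_ , ≤₁)) (inj₂ (PZ , ≤₂)) = inj₂ (PZ , ≤-trans ≤₁ ≤₂)

  largest-witness : ∀ {x} → P x → ∃ λ M → P M × (∀ Y → P Y → f Y ≤ f M)
  largest-witness {x} Px with maximum ≼-total ≼-trans
  ... | M , ≼M with ≼M x
  ...   | inj₁ ¬Px      = contradiction Px ¬Px
  ...   | inj₂ (PM , _) = M , PM , λ Y PY → [ contradiction PY , proj₂ ]′ (≼M Y)

<ᵇ-true : ∀ {m n} → m < n → (m <ᵇ n) ≡ true
<ᵇ-true m<n = Equivalence.to T-≡ (<⇒<ᵇ m<n)

<ᵇ-false : ∀ {m n} → n ≤ m → (m <ᵇ n) ≡ false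
<ᵇ-false {m} {n} n≤m with m <ᵇ n in eq
... | true  = contradiction (<ᵇ⇒< m n (subst T (sym eq) _)) (≤⇒≯ n≤m)
... | false = refl

⟦⟧-∪ : ∀ l a pᵢ qᵢ pⱼ qⱼ → pᵢ ∧ qᵢ ≡ false → pⱼ ∧ qⱼ ≡ false →
       ⟦ l ∧ a ∧ (pᵢ ∨ qᵢ) ∧ (pⱼ ∨ qⱼ) ⟧
       ≡ ⟦ l ∧ a ∧ pᵢ ∧ pⱼ ⟧ + ⟦ l ∧ a ∧ qᵢ ∧ qⱼ ⟧ + (⟦ l ∧ a ∧ qᵢ ∧ pⱼ ⟧ + ⟦ l ∧ a ∧ pᵢ ∧ qⱼ ⟧)
⟦⟧-∪ false a     pᵢ    qᵢ    pⱼ    qⱼ    _  _  = refl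
⟦⟧-∪ true  false pᵢ    qᵢ    pⱼ    qⱼ    _  _  = refl
⟦⟧-∪ true  true  true  true  pⱼ    qⱼ    () _
⟦⟧-∪ true  true  pᵢ    qᵢ    true  true  _  ()
⟦⟧-∪ true  true  true  false true  false _  _  = refl
⟦⟧-∪ true  true  true  false false true  _  _  = refl
⟦⟧-∪ true  true  true  false false false _  _  = refl
⟦⟧-∪ true  true  false true  true  false _  _  = refl
⟦⟧-∪ true  true  false true  false true  _  _  = refl
⟦⟧-∪ true  true  false true  false false _  _  = refl
⟦⟧-∪ true  true  false false pⱼ    qⱼ    _  _  = refl

module _ {n} (G : Graph n) where

  private
    lt : Fin n → Fin n → Bool
    lt i j = toℕ i <ᵇ toℕ j

  eIn≡ΣΣ : ∀ X → eIn G X ≡ ΣΣ λ i j → ⟦ lt i j ∧ adj G i j ∧ lookup X i ∧ lookup X j ⟧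
  eIn≡ΣΣ X = sumF-count≡ΣΣ λ i j → lt i j ∧ adj G i j ∧ lookup X i ∧ lookup X j

  eBetween≡ΣΣ : ∀ X Y → eBetween G X Y ≡ ΣΣ λ i j → ⟦ adj G i j ∧ lookup X i ∧ lookup Y j ⟧
  eBetween≡ΣΣ X Y = sumF-count≡ΣΣ λ i j → adj G i j ∧ lookup X i ∧ lookup Y j

  ⟦adj⟧-split : ∀ i j b →
                ⟦ lt i j ∧ adj G i j ∧ b ⟧ + ⟦ lt j i ∧ adj G i j ∧ b ⟧ ≡ ⟦ adj G i j ∧ b ⟧
  ⟦adj⟧-split i j b with <-cmp (toℕ i) (toℕ j)
  ... | tri< i<j _ _ rewrite <ᵇ-true i<j | <ᵇ-false (<⇒≤ i<j) = +-identityʳ _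
  ... | tri> _ _ j<i rewrite <ᵇ-true j<i | <ᵇ-false (<⇒≤ j<i) = refl
  ... | tri≈ _ i≡j _ rewrite toℕ-injective i≡j | loopless G j | <ᵇ-false (≤-refl {toℕ j}) = refl

  eBetween≡ordered : ∀ P Q →
    ΣΣ (λ i j → ⟦ lt i j ∧ adj G i j ∧ lookup Q i ∧ lookup P j ⟧)
      + ΣΣ (λ i j → ⟦ lt i j ∧ adj G i j ∧ lookup P i ∧ lookup Q j ⟧)
    ≡ eBetween G Q P
  eBetween≡ordered P Q = begin
    ΣΣ forward + ΣΣ (λ i j → ⟦ lt i j ∧ adj G i j ∧ P! i ∧ Q! j ⟧)
      ≡⟨ cong (ΣΣ forward +_) (trans (∑-comm λ i j → ⟦ lt i j ∧ adj G i j ∧ P! i ∧ Q! j ⟧)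
                                     (ΣΣ-cong reversed)) ⟩
    ΣΣ forward + ΣΣ backward
      ≡⟨ sym (ΣΣ-distrib-+ forward backward) ⟩
    ΣΣ (λ i j → forward i j + backward i j)
      ≡⟨ ΣΣ-cong (λ i j → ⟦adj⟧-split i j (Q! i ∧ P! j)) ⟩
    ΣΣ (λ i j → ⟦ adj G i j ∧ Q! i ∧ P! j ⟧)
      ≡⟨ sym (eBetween≡ΣΣ Q P) ⟩
    eBetween G Q P ∎
    where
    open ≡-Reasoning
    P! Q! : Fin n → Bool
    P! = lookup P
    Q! = lookup Q
    forward backward : Fin n → Fin n → ℕ
    forward  i j = ⟦ lt i j ∧ adj G i j ∧ Q! i ∧ P! j ⟧
    backward i j = ⟦ lt j i ∧ adj G i j ∧ Q! i ∧ P! j ⟧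
    reversed : ∀ i j → ⟦ lt j i ∧ adj G j i ∧ P! j ∧ Q! i ⟧ ≡ backward i j
    reversed i j = cong₂ (λ a b → ⟦ lt j i ∧ a ∧ b ⟧) (Graph.sym G j i) (∧-comm (P! j) (Q! i))

  eIn-∪-disjoint : ∀ P Q → (∀ i → lookup P i ∧ lookup Q i ≡ false) →
                   eIn G (P ∪ Q) ≡ eIn G P + eIn G Q + eBetween G Q P
  eIn-∪-disjoint P Q disjoint = begin
    eIn G (P ∪ Q)
      ≡⟨ eIn≡ΣΣ (P ∪ Q) ⟩
    ΣΣ (λ i j → pairs (lookup (P ∪ Q)) (lookup (P ∪ Q)) i j)
      ≡⟨ ΣΣ-cong expand ⟩
    ΣΣ (λ i j → pairs P! P! i j + pairs Q! Q! i j + (pairs Q! P! i j + pairs P! Q! i j))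
      ≡⟨ ΣΣ-distrib-+ (λ i j → pairs P! P! i j + pairs Q! Q! i j) (λ i j → pairs Q! P! i j + pairs P! Q! i j) ⟩
    ΣΣ (λ i j → pairs P! P! i j + pairs Q! Q! i j) + ΣΣ (λ i j → pairs Q! P! i j + pairs P! Q! i j)
      ≡⟨ cong₂ _+_ (ΣΣ-distrib-+ (pairs P! P!) (pairs Q! Q!)) (ΣΣ-distrib-+ (pairs Q! P!) (pairs P! Q!)) ⟩
    ΣΣ (pairs P! P!) + ΣΣ (pairs Q! Q!) + (ΣΣ (pairs Q! P!) + ΣΣ (pairs P! Q!))
      ≡⟨ cong₂ _+_ (cong₂ _+_ (sym (eIn≡ΣΣ P)) (sym (eIn≡ΣΣ Q))) (eBetween≡ordered P Q) ⟩
    eIn G P + eIn G Q + eBetween G Q P ∎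
    where
    open ≡-Reasoning
    P! Q! : Fin n → Bool
    P! = lookup P
    Q! = lookup Q
    pairs : (Fin n → Bool) → (Fin n → Bool) → Fin n → Fin n → ℕ
    pairs X Y i j = ⟦ lt i j ∧ adj G i j ∧ X i ∧ Y j ⟧
    expand : ∀ i j → pairs (lookup (P ∪ Q)) (lookup (P ∪ Q)) i j
                     ≡ pairs P! P! i j + pairs Q! Q! i j + (pairs Q! P! i j + pairs P! Q! i j)
    expand i j rewrite lookup-zipWith _∨_ i P Q | lookup-zipWith _∨_ j P Q =
      ⟦⟧-∪ (lt i j) (adj G i j) (P! i) (Q! i) (P! j) (Q! j) (disjoint i) (disjoint j)

  eIn-⊥ : eIn G ⊥ ≡ 0
  eIn-⊥ = trans (eIn≡ΣΣ ⊥) (ΣΣ-zero _ no-pair)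
    where
    no-pair : ∀ i j → ⟦ lt i j ∧ adj G i j ∧ lookup ⊥ i ∧ lookup ⊥ j ⟧ ≡ 0
    no-pair i j rewrite lookup-replicate {n = n} i false
                      | ∧-zeroʳ (adj G i j) | ∧-zeroʳ (lt i j) = refl

  eIn-∪ : ∀ A R → eIn G (A ∪ R) ≡ eIn G A + eM G R A
  eIn-∪ A R = begin
    eIn G (A ∪ R)                                  ≡⟨ cong (eIn G) (sym (p∪[q─p]≡p∪q A R)) ⟩
    eIn G (A ∪ (R ─ A))                            ≡⟨ eIn-∪-disjoint A (R ─ A) (disjoint-─ A R) ⟩
    eIn G A + eIn G (R ─ A) + eBetween G (R ─ A) A ≡⟨ +-assoc (eIn G A) _ _ ⟩
    eIn G A + eM G R A                             ∎
    where open ≡-Reasoning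

  private
    infix 4 _≤ᵈ_
    _≤ᵈ_ : Subset n → Subset n → Set
    _≤ᵈ_ = _d≤d_ G

    _≤ᵈ?_ : ∀ X Y → Dec (X ≤ᵈ Y)
    X ≤ᵈ? Y = eIn G X * ∣ Y ∣ ≤? eIn G Y * ∣ X ∣

  part≤whole⇒part≤rest : ∀ A R → A ≤ᵈ A ∪ R → eIn G A * ∣ R ─ A ∣ ≤ eM G R A * ∣ A ∣
  part≤whole⇒part≤rest A R A≤A∪R rewrite eIn-∪ A R | ∣p∪q∣≡∣p∣+∣q─p∣ A R =
    ≤-mediant⇒≤ (eIn G A) (∣ A ∣) (eM G R A) (∣ R ─ A ∣) A≤A∪R

  part≤whole⇒whole≤rest : ∀ A R → A ≤ᵈ A ∪ R → eIn G (A ∪ R) * ∣ R ─ A ∣ ≤ eM G R A * ∣ A ∪ R ∣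
  part≤whole⇒whole≤rest A R A≤A∪R =
    subst₂ (λ e c → e * ∣ R ─ A ∣ ≤ eM G R A * c) (sym (eIn-∪ A R)) (sym (∣p∪q∣≡∣p∣+∣q─p∣ A R))
      (≤⇒mediant≤ (eIn G A) (∣ A ∣) (eM G R A) (∣ R ─ A ∣) (part≤whole⇒part≤rest A R A≤A∪R))

  part≰whole⇒rest<part : ∀ A R → ¬ (A ≤ᵈ A ∪ R) → eM G R A * ∣ A ∣ < eIn G A * ∣ R ─ A ∣
  part≰whole⇒rest<part A R A≰A∪R rewrite eIn-∪ A R | ∣p∪q∣≡∣p∣+∣q─p∣ A R =
    mediant<⇒< (eIn G A) (∣ A ∣) (eM G R A) (∣ R ─ A ∣) (≰⇒> A≰A∪R)

  IsDensest : Subset n → Set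
  IsDensest D = Nonempty D × (∀ Y → Nonempty Y → Y ≤ᵈ D)

  densest-bound : ∀ {D} → IsDensest D → ∀ Y → Y ≤ᵈ D
  densest-bound (_ , bound) Y with nonempty? Y
  ... | yes neY = bound Y neY
  ... | no ¬neY rewrite Empty-unique ¬neY | eIn-⊥ = z≤n

  densest-transfer : ∀ {D Z} → IsDensest D → Nonempty Z → D ≤ᵈ Z → IsDensest Z
  densest-transfer {D} {Z} (neD , bound) neZ D≤Z = neZ , λ Y neY →
    cross-≤-trans (eIn G Y) (∣ Y ∣) (eIn G D) (∣ D ∣) (eIn G Z) (∣ Z ∣)
                  (Nonempty⇒0<∣p∣ neD) (bound Y neY) D≤Z

  density : Subset n → ℕ × ℕ
  density X = eIn G X , ∣ X ∣

  densest-exists : Fin n → ∃ IsDensest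
  densest-exists x
    with maximum {_≼_ = _≤ᶠ_ on density} (λ X Y → ≤ᶠ-total (density X) (density Y))
                                         (λ {X} {Y} {Z} → ≤ᶠ-trans {density X} {density Y} {density Z})
  ... | M , ≤M = M , 0<∣p∣⇒Nonempty 0<∣M∣ , bound
    where
    0<∣M∣ : 0 < ∣ M ∣
    0<∣M∣ with ≤M ⊤
    ... | inj₁ ∣⊤∣≡0         = contradiction ∣⊤∣≡0 (>⇒≢ (Nonempty⇒0<∣p∣ (x , ∈⊤)))
    ... | inj₂ (0<∣M∣ , _)   = 0<∣M∣
    bound : ∀ Y → Nonempty Y → Y ≤ᵈ M
    bound Y neY with ≤M Y
    ... | inj₁ ∣Y∣≡0         = contradiction ∣Y∣≡0 (>⇒≢ (Nonempty⇒0<∣p∣ neY))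
    ... | inj₂ (_ , Y≤M)     = Y≤M

  largest-densest-exists : Fin n → ∃ λ D → IsDensest D × (∀ Z → IsDensest Z → ∣ Z ∣ ≤ ∣ D ∣)
  largest-densest-exists x with densest-exists x
  ... | D₀ , densest₀@(neD₀ , _)
    with largest-witness (λ Z → nonempty? Z ×-dec (D₀ ≤ᵈ? Z)) ∣_∣ (neD₀ , ≤-refl)
  ...   | D , (neD , D₀≤D) , largest =
    D , densest-transfer densest₀ neD D₀≤D , λ Z (neZ , bound) → largest Z (neZ , bound D₀ neD₀)

  largest-densest⇒locallyDense : ∀ {D} → IsDensest D → (∀ Z → IsDensest Z → ∣ Z ∣ ≤ ∣ D ∣) →
                                 LocallyDense G D
  largest-densest⇒locallyDense {D} densest largest (X , Y , (x , x∈X) , X⊆D , (y , y∈Y) , Y∩D=∅ , X≤Y) =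
    <⇒≱ outside-sparser (cross-≤-trans (eIn G D) (∣ D ∣) (eM G X (D ─ X)) (∣ X ─ (D ─ X) ∣)
                                        (eM G Y D) (∣ Y ─ D ∣) 0<∣X─[D─X]∣ whole≤inside X≤Y)
    where
    0<∣X─[D─X]∣ : 0 < ∣ X ─ (D ─ X) ∣
    0<∣X─[D─X]∣ = Nonempty⇒0<∣p∣ (x , x∈p∧x∉q⇒x∈p─q x∈X (x∈q⇒x∉p─q x∈X))
    D─X∪X≡D : (D ─ X) ∪ X ≡ D
    D─X∪X≡D = q─p∪p≡q X⊆D
    whole≤inside : eIn G D * ∣ X ─ (D ─ X) ∣ ≤ eM G X (D ─ X) * ∣ D ∣
    whole≤inside = subst (λ U → eIn G U * ∣ X ─ (D ─ X) ∣ ≤ eM G X (D ─ X) * ∣ U ∣) D─X∪X≡D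
      (part≤whole⇒whole≤rest (D ─ X) X (subst (D ─ X ≤ᵈ_) (sym D─X∪X≡D) (densest-bound densest (D ─ X))))
    y∈Y─D : y ∈ Y ─ D
    y∈Y─D = x∈p∧x∉q⇒x∈p─q y∈Y λ y∈D → Y∩D=∅ (y , x∈p∩q⁺ (y∈Y , y∈D))
    ∣D∣<∣D∪Y∣ : ∣ D ∣ < ∣ D ∪ Y ∣
    ∣D∣<∣D∪Y∣ = subst (∣ D ∣ <_) (sym (∣p∪q∣≡∣p∣+∣q─p∣ D Y)) (m<m+n ∣ D ∣ (Nonempty⇒0<∣p∣ (y , y∈Y─D)))
    D≰D∪Y : ¬ (D ≤ᵈ D ∪ Y)
    D≰D∪Y D≤D∪Y = <⇒≱ ∣D∣<∣D∪Y∣ (largest (D ∪ Y) (densest-transfer densest (y , q⊆p∪q D Y y∈Y) D≤D∪Y))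
    outside-sparser : eM G Y D * ∣ D ∣ < eIn G D * ∣ Y ─ D ∣
    outside-sparser = part≰whole⇒rest<part D Y D≰D∪Y

  eM-self : ∀ W → eM G W (W ─ W) ≡ eIn G W
  eM-self W = begin
    eM G W (W ─ W)                 ≡⟨ cong (_+ eM G W (W ─ W)) (trans (cong (eIn G) (p─p≡⊥ W)) eIn-⊥) ⟨
    eIn G (W ─ W) + eM G W (W ─ W) ≡⟨ eIn-∪ (W ─ W) W ⟨
    eIn G ((W ─ W) ∪ W)            ≡⟨ cong (eIn G) (trans (cong (_∪ W) (p─p≡⊥ W)) (∪-identityˡ W)) ⟩
    eIn G W                        ∎
    where open ≡-Reasoning

  eM-─ : ∀ R A → eM G (R ─ A) A ≡ eM G R A
  eM-─ R A = cong (λ U → eIn G U + eBetween G U A) (p─q─q≡p─q R A)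

  locallyDense⊆densest⇒≡ : ∀ {D W} → IsDensest D → LocallyDense G W → Nonempty W → W ⊆ D → W ≡ D
  locallyDense⊆densest⇒≡ {D} {W} densest ldW neW W⊆D = ⊆-antisym W⊆D D⊆W
    where
    part≤rest : eIn G W * ∣ D ─ W ∣ ≤ eM G D W * ∣ W ∣
    part≤rest = part≤whole⇒part≤rest W D (subst (W ≤ᵈ_) (sym (p⊆q⇒p∪q≡q W⊆D)) (densest-bound densest W))
    W≤D─W : dm≤dm G W (W ─ W) (D ─ W) W
    W≤D─W = subst₂ _≤_
      (sym (cong₂ _*_ (eM-self W) (cong ∣_∣ (p─q─q≡p─q D W))))
      (sym (cong₂ _*_ (eM-─ D W) (cong ∣_∣ (trans (cong (W ─_) (p─p≡⊥ W)) (p─⊥≡p W)))))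
      part≤rest
    D─W∩W=∅ : Empty ((D ─ W) ∩ W)
    D─W∩W=∅ (x , x∈D─W∩W) with x∈p∩q⁻ (D ─ W) W x∈D─W∩W
    ... | x∈D─W , x∈W = x∈q⇒x∉p─q x∈W x∈D─W
    D⊆W : D ⊆ W
    D⊆W {x} x∈D with x ∈? W
    ... | yes x∈W = x∈W
    ... | no  x∉W =
      ⊥-elim (ldW (W , D ─ W , neW , ⊆-refl , (x , x∈p∧x∉q⇒x∈p─q x∈D x∉W) , D─W∩W=∅ , W≤D─W))

chain-⊆ : ∀ {m k} (B : Fin (suc k) → Subset m) → (∀ i → B (inject₁ i) ⊆ B (suc i)) → ∀ j → B zero ⊆ B j
chain-⊆ B step zero = ⊆-refl
chain-⊆ {k = suc k} B step (suc j) = ⊆-trans (step zero) (chain-⊆ (B ∘ suc) (step ∘ suc) j)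

nonempty⇒suc-index : ∀ {m k} {B : Fin (suc k) → Subset m} → B zero ≡ ⊥ →
                     ∀ {W} → Nonempty W → ∃ (λ i → B i ≡ W) → ∃ λ j → B (suc j) ≡ W
nonempty⇒suc-index B₀≡⊥ (x , x∈W) (zero  , B₀≡W)   =
  ⊥-elim (∉⊥ (subst (x ∈_) (trans (sym B₀≡W) B₀≡⊥) x∈W))
nonempty⇒suc-index B₀≡⊥ _         (suc j , Bⱼ₊₁≡W) = j , Bⱼ₊₁≡W

densest-in-chain : ∀ {n k} (G : Graph (suc n)) (B : Fin (suc k) → Subset (suc n)) → B zero ≡ ⊥ →
                   (∀ W → LocallyDense G W ⇔ ∃ λ i → B i ≡ W) →
                   ∃ λ j → IsDensest G (B (suc j))
densest-in-chain G B B₀≡⊥ ld⇔B =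
  let (D , densest , largest) = largest-densest-exists G zero
      (j , Bⱼ₊₁≡D) = nonempty⇒suc-index B₀≡⊥ (proj₁ densest)
                       (Equivalence.to (ld⇔B D) (largest-densest⇒locallyDense G densest largest))
  in j , subst (IsDensest G) (sym Bⱼ₊₁≡D) densest

B₁-densest : ∀ {n k} (G : Graph (suc n)) (B : Fin (suc (suc k)) → Subset (suc n)) → B zero ≡ ⊥ →
             (∀ i → B (inject₁ i) ⊂ B (suc i)) → (∀ W → LocallyDense G W ⇔ ∃ λ i → B i ≡ W) →
             IsDensest G (B (suc zero))
B₁-densest G B B₀≡⊥ chain ld⇔B =
  let (j , densest) = densest-in-chain G B B₀≡⊥ ld⇔B
  in subst (IsDensest G) (sym (locallyDense⊆densest⇒≡ G densest B₁-locallyDense B₁-nonempty (B₁⊆ j))) densest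
  where
  B₁-locallyDense : LocallyDense G (B (suc zero))
  B₁-locallyDense = Equivalence.from (ld⇔B (B (suc zero))) (suc zero , refl)
  B₁-nonempty : Nonempty (B (suc zero))
  B₁-nonempty = let (_ , x , x∈B₁ , _) = chain zero in x , x∈B₁
  B₁⊆ : ∀ j → B (suc zero) ⊆ B (suc j)
  B₁⊆ = chain-⊆ (B ∘ suc) (λ i → proj₁ (chain (suc i)))

corollary2 : (n : ℕ) (G : Graph (suc n)) (k : ℕ) (B : Fin (suc k) → Subset (suc n)) →
    B zero ≡ ⊥ → B (fromℕ k) ≡ ⊤ → (∀ (i : Fin k) → B (inject₁ i) ⊂ B (suc i)) →
    (∀ (W : Subset (suc n)) → LocallyDense G W ⇔ (∃ λ i → B i ≡ W)) →
    Σ (Fin (suc k)) λ i → toℕ i ≡ 1 × (∀ (X : Subset (suc n)) → Nonempty X → _d≤d_ G X (B i))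
corollary2 n G zero    B B₀≡⊥ _ _     ld⇔B = ⊥-elim (¬Fin0 (proj₁ (densest-in-chain G B B₀≡⊥ ld⇔B)))
corollary2 n G (suc k) B B₀≡⊥ _ chain ld⇔B = suc zero , refl , proj₂ (B₁-densest G B B₀≡⊥ chain ld⇔B)
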